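{- $M^L(4)=6$, where $M^L(4)$ denotes the minimum cardinality of a local identifying code in the binary $4$-dimensional hypercube.
   Context: The binary $n$-dimensional hypercube is the graph with vertex set $\{0,1\}^n$ in which two binary words are adjacent iff their Hamming distance is $1$. For a vertex $u$, $N[u]$ is its closed neighbourhood, and for a code (nonempty vertex subset) $C$, $I_C(u)=N[u]\cap C$. A code $C$ is a covering code if $I_C(u)\neq\emptyset$ for every vertex $u$. A code $C$ is a local identifying code if it is a covering code and $I_C(u)\neq I_C(v)$ for every pair of adjacent vertices $u,v$. -}

module Defs where

open import Data.Nat using (ℕ; zero; suc; _+_)
open import Data.Bool using (Bool; true; false; _∧_; _∨_; if_then_else_)
open import Data.Vec using (Vec; []; _∷_; zipWith; map; _++_)
open import Data.List using (List; []; _∷_; length; filter; concatMap; sum)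
import Data.List as L
open import Data.Product using (Σ; _×_; ∃)
open import Relation.Binary.PropositionalEquality using (_≡_)
open import Relation.Nullary using (¬_)
open import Data.Bool using (T)

Word : ℕ → Set
Word n = Vec Bool n

hamming : ∀ {n} → Word n → Word n → ℕ
hamming []       []       = 0
hamming (x ∷ xs) (y ∷ ys) = (if x Data.Bool.xor y then 1 else 0) + hamming xs ys
  where import Data.Bool

Adjacent : ∀ {n} → Word n → Word n → Set
Adjacent u v = hamming u v ≡ 1

InClosedNbhd : ∀ {n} → Word n → Word n → Set
InClosedNbhd u w = (w ≡ u) Data.Sum.⊎ Adjacent u w
  where import Data.Sum

-- A code is a subset of the vertex set, given by its (decidable) indicator.
Code : ℕ → Set
Code n = Word n → Bool

InI : ∀ {n} → Code n → Word n → Word n → Set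
InI C u w = InClosedNbhd u w × T (C w)

SameI : ∀ {n} → Code n → Word n → Word n → Set
SameI C u v = ∀ w → (InI C u w → InI C v w) × (InI C v w → InI C u w)

IsCovering : ∀ {n} → Code n → Set
IsCovering C = ∀ u → ∃ λ w → InI C u w

IsLocalIdentifying : ∀ {n} → Code n → Set
IsLocalIdentifying C = IsCovering C × (∀ u v → Adjacent u v → ¬ SameI C u v)

allWords : (n : ℕ) → List (Word n)
allWords zero    = [] ∷ []
allWords (suc n) = concatMap (λ w → (false ∷ w) ∷ (true ∷ w) ∷ []) (allWords n)

size : ∀ {n} → Code n → ℕ
size {n} C = length (L.filter (λ w → Data.Bool.T? (C w)) (allWords n))
  where import Data.Bool

{-# OPTIONS --safe #-}
-- Both bounds are finite computations. N[u] in Q_n is u together with its n one-bit flips,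
-- so I_C(u) = I_C(v) holds iff the codewords of N[u] lie in N[v] and those of N[v] in N[u];
-- this makes the local identifying property decidable by inspecting a few words per vertex.
-- For the lower bound, a code of Q_(n+1) is split into its two halves on Q_n; sharing the
-- size budget between the halves enumerates exactly the 6885 codes of Q_4 with at most 5
-- elements (up to pointwise equality, which the property respects), and none of them is
-- a local identifying code.
module Submission where

open import Defs
open import Data.Nat using (_≤_)
open import Data.Product using (_×_; Σ)
open import Relation.Binary.PropositionalEquality using (_≡_)

open import Data.Bool using (Bool; true; false; T; not; if_then_else_)
open import Data.Bool.Properties using (T?) renaming (_≟_ to _≟ᵇ_)
open import Data.Nat using (ℕ; zero; suc; _+_; _∸_; _≤?_; pred)
open import Data.Nat.Properties
  using (_≟_; ≰⇒>; +-assoc; m≤n+m; m+n≤o⇒m≤o∸n; m∸n+n≡m; +-monoˡ-≤; ≤-trans;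
         +-commutativeSemigroup; module ≤-Reasoning)
open import Algebra.Properties.CommutativeSemigroup +-commutativeSemigroup using (interchange)
open import Data.List using (List; []; _∷_; length; filter; concatMap; map)
open import Data.List.Membership.Propositional using (_∈_; find; lose)
open import Data.List.Membership.Propositional.Properties using (∈-map⁺; ∈-map⁻)
open import Data.List.Relation.Unary.All as All using (all?)
open import Data.List.Relation.Unary.Any using (here; there; any?)
open import Data.Vec using ([]; _∷_)
open import Data.Vec.Properties using (≡-dec)
open import Data.Product using (_,_; ∃; proj₁; proj₂)
open import Data.Sum using (inj₁; inj₂)
open import Data.Unit using (tt)
open import Function using (_∘_)
open import Relation.Binary.Definitions using (DecidableEquality)
open import Relation.Binary.PropositionalEquality
  using (refl; sym; cong; cong₂; subst; _≗_; module ≡-Reasoning)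
open import Relation.Nullary using (Dec; ¬_; ¬?; map′; _×-dec_; _⊎-dec_; _→-dec_)
open import Relation.Nullary.Decidable using (False; isNo; toWitness; toWitnessFalse; fromWitnessFalse)
open import Relation.Unary using (Decidable)

neighbours : ∀ {n} → Word n → List (Word n)
neighbours []      = []
neighbours (b ∷ u) = (not b ∷ u) ∷ map (b ∷_) (neighbours u)

closedNbhd : ∀ {n} → Word n → List (Word n)
closedNbhd u = u ∷ neighbours u

hamming-refl : ∀ {n} (u : Word n) → hamming u u ≡ 0
hamming-refl []          = refl
hamming-refl (false ∷ u) = hamming-refl u
hamming-refl (true ∷ u)  = hamming-refl u

hamming≡0⇒≡ : ∀ {n} (u w : Word n) → hamming u w ≡ 0 → u ≡ w
hamming≡0⇒≡ []          []          _  = refl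
hamming≡0⇒≡ (false ∷ u) (false ∷ w) eq = cong (false ∷_) (hamming≡0⇒≡ u w eq)
hamming≡0⇒≡ (true ∷ u)  (true ∷ w)  eq = cong (true ∷_) (hamming≡0⇒≡ u w eq)

∈-neighbours⇒Adjacent : ∀ {n} (u : Word n) {w} → w ∈ neighbours u → Adjacent u w
∈-neighbours⇒Adjacent (false ∷ u) (here refl) = cong suc (hamming-refl u)
∈-neighbours⇒Adjacent (true ∷ u)  (here refl) = cong suc (hamming-refl u)
∈-neighbours⇒Adjacent (b ∷ u) (there w∈) with ∈-map⁻ (b ∷_) w∈
∈-neighbours⇒Adjacent (false ∷ u) (there _) | w , w∈ , refl = ∈-neighbours⇒Adjacent u w∈
∈-neighbours⇒Adjacent (true ∷ u)  (there _) | w , w∈ , refl = ∈-neighbours⇒Adjacent u w∈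

Adjacent⇒∈-neighbours : ∀ {n} (u w : Word n) → Adjacent u w → w ∈ neighbours u
Adjacent⇒∈-neighbours [] [] ()
Adjacent⇒∈-neighbours (false ∷ u) (true ∷ w)  eq = here (cong (true ∷_) (sym (hamming≡0⇒≡ u w (cong pred eq))))
Adjacent⇒∈-neighbours (true ∷ u)  (false ∷ w) eq = here (cong (false ∷_) (sym (hamming≡0⇒≡ u w (cong pred eq))))
Adjacent⇒∈-neighbours (false ∷ u) (false ∷ w) eq = there (∈-map⁺ (false ∷_) (Adjacent⇒∈-neighbours u w eq))
Adjacent⇒∈-neighbours (true ∷ u)  (true ∷ w)  eq = there (∈-map⁺ (true ∷_) (Adjacent⇒∈-neighbours u w eq))

∈-closedNbhd⇒InClosedNbhd : ∀ {n} (u : Word n) {w} → w ∈ closedNbhd u → InClosedNbhd u w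
∈-closedNbhd⇒InClosedNbhd u (here w≡u) = inj₁ w≡u
∈-closedNbhd⇒InClosedNbhd u (there w∈) = inj₂ (∈-neighbours⇒Adjacent u w∈)

InClosedNbhd⇒∈-closedNbhd : ∀ {n} (u : Word n) {w} → InClosedNbhd u w → w ∈ closedNbhd u
InClosedNbhd⇒∈-closedNbhd u (inj₁ w≡u) = here w≡u
InClosedNbhd⇒∈-closedNbhd u (inj₂ u~w) = there (Adjacent⇒∈-neighbours u _ u~w)

_≟ʷ_ : ∀ {n} → DecidableEquality (Word n)
_≟ʷ_ = ≡-dec _≟ᵇ_

InClosedNbhd? : ∀ {n} (u w : Word n) → Dec (InClosedNbhd u w)
InClosedNbhd? u w = (w ≟ʷ u) ⊎-dec (hamming u w ≟ 1)

∀-Word? : ∀ {n} {P : Word n → Set} → Decidable P → Dec (∀ w → P w)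
∀-Word? {zero} P? = map′ (λ { p [] → p }) (λ h → h []) (P? [])
∀-Word? {suc n} P? =
  map′ (λ { (h₀ , h₁) (false ∷ w) → h₀ w ; (h₀ , h₁) (true ∷ w) → h₁ w })
       (λ h → h ∘ (false ∷_) , h ∘ (true ∷_))
       (∀-Word? (P? ∘ (false ∷_)) ×-dec ∀-Word? (P? ∘ (true ∷_)))

module _ {n : ℕ} (C : Code n) where

  _⊆I_ : Word n → Word n → Set
  u ⊆I v = ∀ {w} → InI C u w → InI C v w

  ⊆I? : ∀ u v → Dec (u ⊆I v)
  ⊆I? u v =
    map′ (λ all (u~w , w∈C) → All.lookup all (InClosedNbhd⇒∈-closedNbhd u u~w) w∈C , w∈C)
         (λ u⊆v → All.tabulate λ w∈ w∈C → proj₁ (u⊆v (∈-closedNbhd⇒InClosedNbhd u w∈ , w∈C)))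
         (all? (λ w → T? (C w) →-dec InClosedNbhd? v w) (closedNbhd u))

  SameI? : ∀ u v → Dec (SameI C u v)
  SameI? u v = map′ (λ (u⊆v , v⊆u) _ → (λ i → u⊆v i) , (λ i → v⊆u i))
                    (λ same → (λ {w} → proj₁ (same w)) , (λ {w} → proj₂ (same w)))
                    (⊆I? u v ×-dec ⊆I? v u)

  covered? : ∀ u → Dec (∃ (InI C u))
  covered? u =
    map′ (λ any → let w , w∈ , w∈C = find any in w , ∈-closedNbhd⇒InClosedNbhd u w∈ , w∈C)
         (λ (w , u~w , w∈C) → lose (InClosedNbhd⇒∈-closedNbhd u u~w) w∈C)
         (any? (T? ∘ C) (closedNbhd u))

  separated? : ∀ u → Dec (∀ v → Adjacent u v → ¬ SameI C u v)
  separated? u =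
    map′ (λ all v u~v → All.lookup all (Adjacent⇒∈-neighbours u v u~v))
         (λ sep → All.tabulate λ v∈ → sep _ (∈-neighbours⇒Adjacent u v∈))
         (all? (¬? ∘ SameI? u) (neighbours u))

  IsLocalIdentifying? : Dec (IsLocalIdentifying C)
  IsLocalIdentifying? = ∀-Word? covered? ×-dec ∀-Word? separated?

InI-resp : ∀ {n} {C D : Code n} → C ≗ D → ∀ {u w} → InI C u w → InI D u w
InI-resp C≗D {w = w} (u~w , w∈C) = u~w , subst T (C≗D w) w∈C

SameI-resp : ∀ {n} {C D : Code n} → C ≗ D → ∀ {u v} → SameI C u v → SameI D u v
SameI-resp C≗D same w =
    (InI-resp C≗D ∘ proj₁ (same w) ∘ InI-resp (sym ∘ C≗D))
  , (InI-resp C≗D ∘ proj₂ (same w) ∘ InI-resp (sym ∘ C≗D))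

IsLocalIdentifying-resp : ∀ {n} {C D : Code n} → C ≗ D → IsLocalIdentifying C → IsLocalIdentifying D
IsLocalIdentifying-resp C≗D (covers , separates) =
    (λ u → let w , w∈I = covers u in w , InI-resp C≗D w∈I)
  , (λ u v u~v → separates u v u~v ∘ SameI-resp (sym ∘ C≗D))

count : ∀ {n} → Code n → List (Word n) → ℕ
count C ws = length (filter (λ w → T? (C w)) ws)

count-∷ : ∀ {n} (C : Code n) w ws → count C (w ∷ ws) ≡ (if C w then 1 else 0) + count C ws
count-∷ C w ws with C w
... | true  = refl
... | false = refl

count-concatMap-∷ : ∀ {n} (C : Code (suc n)) (ws : List (Word n)) →
  count C (concatMap (λ w → (false ∷ w) ∷ (true ∷ w) ∷ []) ws)
    ≡ count (C ∘ (false ∷_)) ws + count (C ∘ (true ∷_)) ws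
count-concatMap-∷ C [] = refl
count-concatMap-∷ C (w ∷ ws) = begin
  count C (w₀ ∷ w₁ ∷ rest)                ≡⟨ count-∷ C w₀ _ ⟩
  a + count C (w₁ ∷ rest)                 ≡⟨ cong (a +_) (count-∷ C w₁ rest) ⟩
  a + (b + count C rest)                  ≡⟨ +-assoc a b _ ⟨
  (a + b) + count C rest                  ≡⟨ cong ((a + b) +_) (count-concatMap-∷ C ws) ⟩
  (a + b) + (count C₀ ws + count C₁ ws)   ≡⟨ interchange a b _ _ ⟩
  (a + count C₀ ws) + (b + count C₁ ws)   ≡⟨ cong₂ _+_ (count-∷ C₀ w ws) (count-∷ C₁ w ws) ⟨
  count C₀ (w ∷ ws) + count C₁ (w ∷ ws)   ∎
  where
  open ≡-Reasoning
  w₀ w₁ : Word _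
  w₀ = false ∷ w
  w₁ = true ∷ w
  C₀ C₁ : Code _
  C₀ = C ∘ (false ∷_)
  C₁ = C ∘ (true ∷_)
  a b : ℕ
  a = if C w₀ then 1 else 0
  b = if C w₁ then 1 else 0
  rest = concatMap (λ w → (false ∷ w) ∷ (true ∷ w) ∷ []) ws

size-∷ : ∀ {n} (C : Code (suc n)) → size C ≡ size (C ∘ (false ∷_)) + size (C ∘ (true ∷_))
size-∷ {n} C = count-concatMap-∷ C (allWords n)

size-cong : ∀ {n} {C D : Code n} → C ≗ D → size C ≡ size D
size-cong {n} {C} {D} C≗D = go (allWords n)
  where
  go : ∀ ws → count C ws ≡ count D ws
  go [] = refl
  go (w ∷ ws) = begin
    count C (w ∷ ws)                          ≡⟨ count-∷ C w ws ⟩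
    (if C w then 1 else 0) + count C ws       ≡⟨ cong₂ (λ b c → (if b then 1 else 0) + c) (C≗D w) (go ws) ⟩
    (if D w then 1 else 0) + count D ws       ≡⟨ count-∷ D w ws ⟨
    count D (w ∷ ws)                          ∎
    where open ≡-Reasoning

glue : ∀ {n} → Code n → Code n → Code (suc n)
glue C₀ C₁ (false ∷ w) = C₀ w
glue C₀ C₁ (true ∷ w)  = C₁ w

glue-η : ∀ {n} (C : Code (suc n)) → glue (C ∘ (false ∷_)) (C ∘ (true ∷_)) ≗ C
glue-η C (false ∷ w) = refl
glue-η C (true ∷ w)  = refl

glue-cong : ∀ {n} {C₀ C₁ D₀ D₁ : Code n} → C₀ ≗ D₀ → C₁ ≗ D₁ → glue C₀ C₁ ≗ glue D₀ D₁
glue-cong eq₀ eq₁ (false ∷ w) = eq₀ w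
glue-cong eq₀ eq₁ (true ∷ w)  = eq₁ w

size-glue : ∀ {n} (C₀ C₁ : Code n) → size (glue C₀ C₁) ≡ size C₀ + size C₁
size-glue C₀ C₁ = size-∷ (glue C₀ C₁)

Extensional : ∀ {n} → (Code n → Set) → Set
Extensional P = ∀ {C D} → C ≗ D → P C → P D

∀-size≤? : ∀ {n} k {P : Code n → Set} → Extensional P → Decidable P → Dec (∀ C → size C ≤ k → P C)
∀-size≤? {zero} k {P} resp P? =
  map′ (λ (h₀ , h₁) C →
         resp (const-η C) ∘ byValue h₀ h₁ (C []) ∘ subst (_≤ k) (size-cong (sym ∘ const-η C)))
       (λ h → h _ , h _)
       (decideAt false ×-dec decideAt true)
  where
  AtValue : Bool → Set
  AtValue b = size {0} (λ _ → b) ≤ k → P (λ _ → b)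

  decideAt : ∀ b → Dec (AtValue b)
  decideAt b = size {0} (λ _ → b) ≤? k →-dec P? _

  byValue : AtValue false → AtValue true → ∀ b → AtValue b
  byValue h₀ h₁ false = h₀
  byValue h₀ h₁ true  = h₁

  const-η : (C : Code 0) → (λ _ → C []) ≗ C
  const-η C [] = refl

∀-size≤? {suc n} k {P} resp P? =
  map′ fromHalves toHalves
       (∀-size≤? k resp₁ λ C₁ →
          ∀-size≤? (k ∸ size C₁) (λ eq → resp (glue-cong eq (λ _ → refl))) λ C₀ → P? (glue C₀ C₁))
  where
  Halves : Code n → Set
  Halves C₁ = ∀ C₀ → size C₀ ≤ k ∸ size C₁ → P (glue C₀ C₁)

  resp₁ : Extensional Halves
  resp₁ C₁≗D₁ h C₀ le =
    resp (glue-cong (λ _ → refl) C₁≗D₁) (h C₀ (subst (λ s → size C₀ ≤ k ∸ s) (sym (size-cong C₁≗D₁)) le))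

  fromHalves : (∀ C₁ → size C₁ ≤ k → Halves C₁) → ∀ C → size C ≤ k → P C
  fromHalves h C le = resp (glue-η C) (h C₁ (≤-trans (m≤n+m _ _) le′) C₀ (m+n≤o⇒m≤o∸n _ le′))
    where
    C₀ C₁ : Code n
    C₀ = C ∘ (false ∷_)
    C₁ = C ∘ (true ∷_)
    le′ : size C₀ + size C₁ ≤ k
    le′ = subst (_≤ k) (size-∷ C) le

  toHalves : (∀ C → size C ≤ k → P C) → ∀ C₁ → size C₁ ≤ k → Halves C₁
  toHalves h C₁ le₁ C₀ le₀ = h (glue C₀ C₁) (begin
    size (glue C₀ C₁)        ≡⟨ size-glue C₀ C₁ ⟩
    size C₀ + size C₁        ≤⟨ +-monoˡ-≤ (size C₁) le₀ ⟩
    k ∸ size C₁ + size C₁    ≡⟨ m∸n+n≡m le₁ ⟩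
    k                        ∎)
    where open ≤-Reasoning

noLocalIdentifyingCodeOfSize≤5 : ∀ (C : Code 4) → size C ≤ 5 → ¬ IsLocalIdentifying C
noLocalIdentifyingCodeOfSize≤5 C size≤5 = toWitnessFalse (rejectsSmallCodes C size≤5)
  where
  resp : Extensional (False ∘ IsLocalIdentifying?)
  resp C≗D notC = fromWitnessFalse (toWitnessFalse notC ∘ IsLocalIdentifying-resp (sym ∘ C≗D))

  -- Deciding `False (IsLocalIdentifying? C)` with T? instead of `¬ IsLocalIdentifying C`
  -- with ¬? cuts the memory used by the type checker's evaluation about threefold.
  rejectsSmallCodes : ∀ C → size C ≤ 5 → False (IsLocalIdentifying? C)
  rejectsSmallCodes = toWitness {a? = ∀-size≤? 5 resp (T? ∘ isNo ∘ IsLocalIdentifying?)} tt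

sixElementCode : Code 4
sixElementCode (false ∷ false ∷ false ∷ false ∷ []) = true
sixElementCode (true  ∷ false ∷ false ∷ false ∷ []) = true
sixElementCode (false ∷ true  ∷ false ∷ false ∷ []) = true
sixElementCode (true  ∷ true  ∷ false ∷ false ∷ []) = true
sixElementCode (false ∷ false ∷ true  ∷ true  ∷ []) = true
sixElementCode (true  ∷ true  ∷ true  ∷ true  ∷ []) = true
sixElementCode _                                    = false

sixElementCode-isLocalIdentifying : IsLocalIdentifying sixElementCode
sixElementCode-isLocalIdentifying = toWitness {a? = IsLocalIdentifying? sixElementCode} tt

mainTheorem4 : Σ (Code 4) (λ C → IsLocalIdentifying C × size C ≡ 6)
               × (∀ (C : Code 4) → IsLocalIdentifying C → 6 ≤ size C)
mainTheorem4 =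
    (sixElementCode , sixElementCode-isLocalIdentifying , refl)
  , λ C isLocId → ≰⇒> λ size≤5 → noLocalIdentifyingCodeOfSize≤5 C size≤5 isLocId
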